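{- For every positive integer $m$, define $$\xi(m):= \sum_{k=0}^m \binom{m}{k} \left( \frac{k}{m} \right)^k \left( 1-\frac{k}{m} \right)^{m-k}$$ and $$\xi_2(m):= \sum_{j=0}^m \sum_{k=0}^{m-j} \binom{m}{j} \binom{m-j}{k} \left( \frac{j}{m} \right)^j \left( \frac{k}{m} \right)^k \left( 1-\frac{j}{m}-\frac{k}{m} \right)^{m-j-k}.$$ Then for every positive integer $m$, $$\xi(m) = \frac{1}{m^m} \sum_{j=0}^m m^j \frac{m!}{j!}, \qquad \xi_2(m) = \frac{1}{m^m}\sum_{j=0}^m m^{m-j} \binom{m}{j} (j+1)!,$$ and furthermore $$\xi_2(m) = \xi(m)+m.$$
   Context: Here $m$ ranges over the positive integers $\mathbb{N}=\{1,2,3,\dots\}$ (so that $k/m$ is defined), and the convention $0^0=1$ is used in the sums. -}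

module Defs where

open import Data.Nat using (ℕ; zero; suc; _∸_; NonZero; _!)
import Data.Nat as ℕ
open import Data.Nat.Properties using (m^n≢0; _!≢0)
open import Data.Nat.Combinatorics using (_C_)
open import Data.Integer using (+_)
open import Data.Rational using (ℚ; 0ℚ; 1ℚ; _+_; _-_; _*_; _/_)

-- x ^ n in ℚ, by recursion; in particular x ^ 0 = 1 (so 0 ^ 0 = 1).
infixr 8 _^ℚ_
_^ℚ_ : ℚ → ℕ → ℚ
x ^ℚ zero  = 1ℚ
x ^ℚ suc n = x * (x ^ℚ n)

Σ[0…_] : ℕ → (ℕ → ℚ) → ℚ
Σ[0… zero  ] f = f 0
Σ[0… suc n ] f = Σ[0… n ] f + f (suc n)

ι : ℕ → ℚ
ι n = + n / 1

frac : ℕ → (m : ℕ) → .{{NonZero m}} → ℚ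
frac k m = + k / m

ξ : (m : ℕ) → .{{NonZero m}} → ℚ
ξ m = Σ[0… m ] λ k →
  ι (m C k) * (frac k m ^ℚ k) * ((1ℚ - frac k m) ^ℚ (m ∸ k))

ξ₂ : (m : ℕ) → .{{NonZero m}} → ℚ
ξ₂ m = Σ[0… m ] λ j → Σ[0… m ∸ j ] λ k →
  ι (m C j) * ι ((m ∸ j) C k) * (frac j m ^ℚ j) * (frac k m ^ℚ k)
    * ((1ℚ - frac j m - frac k m) ^ℚ (m ∸ j ∸ k))

invPow : (m : ℕ) → .{{NonZero m}} → ℚ
invPow m = (+ 1 / (m ℕ.^ m)) {{m^n≢0 m m}}

divFact : ℕ → ℕ → ℚ
divFact a j = (+ a / (j !)) {{j !≢0}}

rhs₁ : (m : ℕ) → .{{NonZero m}} → ℚ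
rhs₁ m = invPow m * (Σ[0… m ] λ j → ι (m ℕ.^ j) * divFact (m !) j)

rhs₂ : (m : ℕ) → .{{NonZero m}} → ℚ
rhs₂ m = invPow m * (Σ[0… m ] λ j → ι (m ℕ.^ (m ∸ j)) * ι (m C j) * ι (suc j !))

module Submission where

-- Multiplied by m^m, ξ(m) and ξ₂(m) become the binomial convolutions D ⋆ D and D ⋆ (D ⋆ D) of
-- D(k) = k^k.  Abel's identity Σ C(n,k) x(x+k)^(k-1) (y+n-k)^(n-k) = (x+y+n)^n says that convolving
-- with the Abel polynomial x(x+k)^(k-1) only shifts the parameter of (y+l)^l.  As
-- (x+l)^l = x(x+l)^(l-1) + l·(x+1+(l-1))^(l-1), induction on n then shows that convolving F_s with
-- (x+l)^l yields the solution of G_s(n+1) = F_s(n+1) + (n+1)·G_{s+1}(n) at parameter x+s.  Solving this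
-- recurrence once and twice, starting from (s+n)^n, gives Σ C(n,t) (s+n)^(n-t) t! and
-- Σ C(n,t) (s+n)^(n-t) (t+1)!, the two closed forms at s = 0; comparing the two recurrences shows that
-- the numerators differ by m^(m+1), i.e. ξ₂(m) = ξ(m) + m.

open import Defs
open import Data.Nat using (ℕ; NonZero)
open import Data.Product using (_×_; _,_)
open import Relation.Binary.PropositionalEquality using (_≡_)

module AbelConvolution where

  open import Data.Nat
  open import Data.Nat.Properties
  open import Data.Nat.DivMod using (m/n*n≡m)
  open import Data.Nat.Combinatorics using (_C_; k![n∸k]!∣n!; nCk≡nC[n∸k]; nCk+nC[k+1]≡[n+1]C[k+1])
  open import Data.Nat.Combinatorics.Specification using (nCk≡n!/k![n-k]!; k>n⇒nCk≡0)
  open import Data.Nat.Tactic.RingSolver using (solve-∀)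
  open import Algebra.Properties.CommutativeSemigroup +-commutativeSemigroup using (x∙yz≈y∙xz) renaming (interchange to +-interchange)
  open import Function using (_∘_)
  open import Relation.Binary.PropositionalEquality
  open import Relation.Nullary using (yes; no)
  open ≡-Reasoning

  nCk*[k!*[n∸k]!]≡n! : ∀ {n k} → k ≤ n → (n C k) * (k ! * (n ∸ k) !) ≡ n !
  nCk*[k!*[n∸k]!]≡n! {n} {k} k≤n = trans (cong (_* (k ! * (n ∸ k) !)) (nCk≡n!/k![n-k]! k≤n))
                                         (m/n*n≡m {{k !* (n ∸ k) !≢0}} (k![n∸k]!∣n! k≤n))

  [1+k]*[1+n]C[1+k]≡[1+n]*nCk : ∀ n k → suc k * (suc n C suc k) ≡ suc n * (n C k)
  [1+k]*[1+n]C[1+k]≡[1+n]*nCk n k with k ≤? n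
  ... | no k≰n rewrite k>n⇒nCk≡0 (s≤s (≰⇒> k≰n)) | k>n⇒nCk≡0 (≰⇒> k≰n) = trans (*-zeroʳ (suc k)) (sym (*-zeroʳ (suc n)))
  ... | yes k≤n = *-cancelʳ-≡ _ _ (k ! * (n ∸ k) !) {{k !* (n ∸ k) !≢0}} (begin
    suc k * (suc n C suc k) * (k ! * (n ∸ k) !) ≡⟨ regroup (suc k) (suc n C suc k) (k !) ((n ∸ k) !) ⟩
    (suc n C suc k) * (suc k ! * (n ∸ k) !)       ≡⟨ nCk*[k!*[n∸k]!]≡n! (s≤s k≤n) ⟩
    suc n !                                     ≡⟨ cong (suc n *_) (nCk*[k!*[n∸k]!]≡n! k≤n) ⟨
    suc n * ((n C k) * (k ! * (n ∸ k) !))         ≡⟨ *-assoc (suc n) (n C k) _ ⟨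
    suc n * (n C k) * (k ! * (n ∸ k) !)           ∎)
    where
    regroup : ∀ a b c d → a * b * (c * d) ≡ b * (a * c * d)
    regroup = solve-∀

  Σℕ[0…_] : ℕ → (ℕ → ℕ) → ℕ
  Σℕ[0… zero  ] f = f 0
  Σℕ[0… suc n ] f = Σℕ[0… n ] f + f (suc n)

  Σℕ-cong : ∀ n {f g : ℕ → ℕ} → (∀ k → k ≤ n → f k ≡ g k) → Σℕ[0… n ] f ≡ Σℕ[0… n ] g
  Σℕ-cong zero    f≗g = f≗g 0 z≤n
  Σℕ-cong (suc n) f≗g = cong₂ _+_ (Σℕ-cong n λ k k≤n → f≗g k (m≤n⇒m≤1+n k≤n)) (f≗g (suc n) ≤-refl)

  Σℕ-distrib-+ : ∀ n (f g : ℕ → ℕ) → Σℕ[0… n ] (λ k → f k + g k) ≡ Σℕ[0… n ] f + Σℕ[0… n ] g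
  Σℕ-distrib-+ zero    f g = refl
  Σℕ-distrib-+ (suc n) f g = begin
    Σℕ[0… n ] (λ k → f k + g k) + (f (suc n) + g (suc n))    ≡⟨ cong (_+ (f (suc n) + g (suc n))) (Σℕ-distrib-+ n f g) ⟩
    Σℕ[0… n ] f + Σℕ[0… n ] g + (f (suc n) + g (suc n))      ≡⟨ +-interchange (Σℕ[0… n ] f) _ _ _ ⟩
    Σℕ[0… n ] f + f (suc n) + (Σℕ[0… n ] g + g (suc n))      ∎

  Σℕ-distribˡ-* : ∀ n c (f : ℕ → ℕ) → Σℕ[0… n ] (λ k → c * f k) ≡ c * Σℕ[0… n ] f
  Σℕ-distribˡ-* zero    c f = refl
  Σℕ-distribˡ-* (suc n) c f = begin
    Σℕ[0… n ] (λ k → c * f k) + c * f (suc n) ≡⟨ cong (_+ c * f (suc n)) (Σℕ-distribˡ-* n c f) ⟩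
    c * Σℕ[0… n ] f + c * f (suc n)           ≡⟨ *-distribˡ-+ c (Σℕ[0… n ] f) (f (suc n)) ⟨
    c * (Σℕ[0… n ] f + f (suc n))             ∎

  Σℕ-zero : ∀ n → Σℕ[0… n ] (λ _ → 0) ≡ 0
  Σℕ-zero zero    = refl
  Σℕ-zero (suc n) = cong (_+ 0) (Σℕ-zero n)

  Σℕ-unfoldˡ : ∀ n (f : ℕ → ℕ) → Σℕ[0… suc n ] f ≡ f 0 + Σℕ[0… n ] (f ∘ suc)
  Σℕ-unfoldˡ zero    f = refl
  Σℕ-unfoldˡ (suc n) f = trans (cong (_+ f (2 + n)) (Σℕ-unfoldˡ n f)) (+-assoc (f 0) _ _)

  Σℕ-reverse : ∀ n (f : ℕ → ℕ) → Σℕ[0… n ] f ≡ Σℕ[0… n ] (λ k → f (n ∸ k))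
  Σℕ-reverse zero    f = refl
  Σℕ-reverse (suc n) f = begin
    Σℕ[0… suc n ] f                          ≡⟨ Σℕ-unfoldˡ n f ⟩
    f 0 + Σℕ[0… n ] (f ∘ suc)                ≡⟨ cong (f 0 +_) (Σℕ-reverse n (f ∘ suc)) ⟩
    f 0 + Σℕ[0… n ] (λ k → f (suc (n ∸ k)))  ≡⟨ +-comm (f 0) _ ⟩
    Σℕ[0… n ] (λ k → f (suc (n ∸ k))) + f 0  ≡⟨ cong₂ _+_ (Σℕ-cong n λ k k≤n → cong f (+-∸-assoc 1 k≤n)) (cong f (n∸n≡0 n)) ⟨
    Σℕ[0… suc n ] (λ k → f (suc n ∸ k))      ∎

  -- The coefficients of the product of two exponential generating functions.
  infixl 7 _⋆_
  _⋆_ : (ℕ → ℕ) → (ℕ → ℕ) → ℕ → ℕ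
  (f ⋆ g) n = Σℕ[0… n ] λ k → (n C k) * f k * g (n ∸ k)

  ⋆-cong : ∀ {f f′ g g′ : ℕ → ℕ} → (∀ k → f k ≡ f′ k) → (∀ k → g k ≡ g′ k) → ∀ n → (f ⋆ g) n ≡ (f′ ⋆ g′) n
  ⋆-cong f≗f′ g≗g′ n = Σℕ-cong n λ k _ → cong₂ (λ a b → (n C k) * a * b) (f≗f′ k) (g≗g′ (n ∸ k))

  ⋆-comm : ∀ f g n → (f ⋆ g) n ≡ (g ⋆ f) n
  ⋆-comm f g n = trans (Σℕ-reverse n _) (Σℕ-cong n λ k k≤n → begin
    (n C (n ∸ k)) * f (n ∸ k) * g (n ∸ (n ∸ k)) ≡⟨ cong₂ (λ a b → a * f (n ∸ k) * g b) (sym (nCk≡nC[n∸k] k≤n)) (m∸[m∸n]≡n k≤n) ⟩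
    (n C k) * f (n ∸ k) * g k                   ≡⟨ *-assoc (n C k) _ _ ⟩
    (n C k) * (f (n ∸ k) * g k)                 ≡⟨ cong ((n C k) *_) (*-comm (f (n ∸ k)) (g k)) ⟩
    (n C k) * (g k * f (n ∸ k))                 ≡⟨ *-assoc (n C k) _ _ ⟨
    (n C k) * g k * f (n ∸ k)                   ∎)

  ⋆-distribˡ-+ : ∀ f g h n → (f ⋆ (λ l → g l + h l)) n ≡ (f ⋆ g) n + (f ⋆ h) n
  ⋆-distribˡ-+ f g h n =
    trans (Σℕ-cong n λ k _ → *-distribˡ-+ ((n C k) * f k) (g (n ∸ k)) (h (n ∸ k))) (Σℕ-distrib-+ n _ _)

  ⋆-scaleʳ : ∀ c f g n → (f ⋆ (λ l → c * g l)) n ≡ c * (f ⋆ g) n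
  ⋆-scaleʳ c f g n = trans (Σℕ-cong n λ k _ → pull-out ((n C k) * f k) c (g (n ∸ k))) (Σℕ-distribˡ-* n c _)
    where
    pull-out : ∀ a c b → a * (c * b) ≡ c * (a * b)
    pull-out = solve-∀

  δ₀ : ℕ → ℕ
  δ₀ zero    = 1
  δ₀ (suc _) = 0

  ⋆-identityʳ : ∀ g n → (g ⋆ δ₀) n ≡ g n
  ⋆-identityʳ g zero    = trans (*-identityʳ _) (+-identityʳ (g 0))
  ⋆-identityʳ g (suc n) = begin
    (g ⋆ δ₀) (suc n)                                                       ≡⟨ ⋆-comm g δ₀ (suc n) ⟩
    (δ₀ ⋆ g) (suc n)                                                       ≡⟨ Σℕ-unfoldˡ n _ ⟩
    1 * 1 * g (suc n) + Σℕ[0… n ] (λ k → (suc n C suc k) * 0 * g (n ∸ k)) ≡⟨ cong₂ _+_ (+-identityʳ (g (suc n))) vanishing ⟩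
    g (suc n) + 0                                                          ≡⟨ +-identityʳ (g (suc n)) ⟩
    g (suc n)                                                              ∎
    where
    vanishing : Σℕ[0… n ] (λ k → (suc n C suc k) * 0 * g (n ∸ k)) ≡ 0
    vanishing = trans (Σℕ-cong n λ k _ → cong (_* g (n ∸ k)) (*-zeroʳ (suc n C suc k))) (Σℕ-zero n)

  ⋆-shiftˡ : ∀ g f n → ((λ l → l * g (l ∸ 1)) ⋆ f) (suc n) ≡ suc n * (g ⋆ f) n
  ⋆-shiftˡ g f n = trans (Σℕ-unfoldˡ n _) (trans (Σℕ-cong n λ k _ → absorb k) (Σℕ-distribˡ-* n (suc n) _))
    where
    regroup₁ : ∀ a b c d → a * (b * c) * d ≡ b * a * (c * d)
    regroup₁ = solve-∀
    regroup₂ : ∀ a b c d → a * b * (c * d) ≡ a * (b * c * d)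
    regroup₂ = solve-∀
    absorb : ∀ k → (suc n C suc k) * (suc k * g k) * f (n ∸ k) ≡ suc n * ((n C k) * g k * f (n ∸ k))
    absorb k = begin
      (suc n C suc k) * (suc k * g k) * f (n ∸ k)   ≡⟨ regroup₁ (suc n C suc k) (suc k) (g k) (f (n ∸ k)) ⟩
      suc k * (suc n C suc k) * (g k * f (n ∸ k))   ≡⟨ cong (_* (g k * f (n ∸ k))) ([1+k]*[1+n]C[1+k]≡[1+n]*nCk n k) ⟩
      suc n * (n C k) * (g k * f (n ∸ k))           ≡⟨ regroup₂ (suc n) (n C k) (g k) (f (n ∸ k)) ⟩
      suc n * ((n C k) * g k * f (n ∸ k))           ∎

  ⋆-leibniz : ∀ f g n → (f ⋆ g) (suc n) ≡ (f ⋆ (g ∘ suc)) n + ((f ∘ suc) ⋆ g) n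
  ⋆-leibniz f g n = begin
    (f ⋆ g) (suc n)        ≡⟨ Σℕ-unfoldˡ n _ ⟩
    h 0 + Σℕ[0… n ] (λ k → (suc n C suc k) * f (suc k) * g (n ∸ k)) ≡⟨ cong (h 0 +_) (trans (Σℕ-cong n λ k _ → pascal k) (Σℕ-distrib-+ n _ _)) ⟩
    h 0 + (Y + ((f ∘ suc) ⋆ g) n)             ≡⟨ +-assoc (h 0) Y _ ⟨
    h 0 + Y + ((f ∘ suc) ⋆ g) n               ≡⟨ cong (_+ ((f ∘ suc) ⋆ g) n) lower ⟩
    (f ⋆ (g ∘ suc)) n + ((f ∘ suc) ⋆ g) n     ∎
    where
    h : ℕ → ℕ
    h k = (n C k) * f k * g (suc n ∸ k)
    Y : ℕ
    Y = Σℕ[0… n ] (λ k → (n C suc k) * f (suc k) * g (n ∸ k))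
    pascal : ∀ k → (suc n C suc k) * f (suc k) * g (n ∸ k) ≡ (n C suc k) * f (suc k) * g (n ∸ k) + (n C k) * f (suc k) * g (n ∸ k)
    pascal k = begin
      (suc n C suc k) * f (suc k) * g (n ∸ k)
        ≡⟨ cong (λ c → c * f (suc k) * g (n ∸ k)) (trans (+-comm (n C suc k) (n C k)) (nCk+nC[k+1]≡[n+1]C[k+1] n k)) ⟨
      ((n C suc k) + (n C k)) * f (suc k) * g (n ∸ k)
        ≡⟨ cong (_* g (n ∸ k)) (*-distribʳ-+ (f (suc k)) (n C suc k) (n C k)) ⟩
      ((n C suc k) * f (suc k) + (n C k) * f (suc k)) * g (n ∸ k)
        ≡⟨ *-distribʳ-+ (g (n ∸ k)) ((n C suc k) * f (suc k)) ((n C k) * f (suc k)) ⟩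
      (n C suc k) * f (suc k) * g (n ∸ k) + (n C k) * f (suc k) * g (n ∸ k)
        ∎
    lower : h 0 + Y ≡ (f ⋆ (g ∘ suc)) n
    lower = begin
      h 0 + Y                        ≡⟨ Σℕ-unfoldˡ n h ⟨
      Σℕ[0… n ] h + h (suc n)        ≡⟨ cong (λ c → Σℕ[0… n ] h + c * f (suc n) * g (n ∸ n)) (k>n⇒nCk≡0 (n<1+n n)) ⟩
      Σℕ[0… n ] h + 0                ≡⟨ +-identityʳ _ ⟩
      Σℕ[0… n ] h                    ≡⟨ Σℕ-cong n (λ k k≤n → cong (λ l → (n C k) * f k * g l) (+-∸-assoc 1 k≤n)) ⟩
      (f ⋆ (g ∘ suc)) n              ∎

  -- As exponential generating functions in the index l: G s = F s + z · G (1 + s).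
  _SplitsAlong_ : (G F : ℕ → ℕ → ℕ) → Set
  G SplitsAlong F = ∀ s l → G s l ≡ F s l + l * G (suc s) (l ∸ 1)

  ⋆-split : ∀ {G F} → G SplitsAlong F → ∀ g s n → (g ⋆ G s) (suc n) ≡ (g ⋆ F s) (suc n) + suc n * (g ⋆ G (suc s)) n
  ⋆-split {G} {F} G-split g s n = begin
    (g ⋆ G s) (suc n)                                          ≡⟨ ⋆-cong (λ _ → refl) (G-split s) (suc n) ⟩
    (g ⋆ (λ l → F s l + l * G (suc s) (l ∸ 1))) (suc n)        ≡⟨ ⋆-distribˡ-+ g (F s) shift (suc n) ⟩
    (g ⋆ F s) (suc n) + (g ⋆ shift) (suc n)                    ≡⟨ cong ((g ⋆ F s) (suc n) +_) shifted ⟩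
    (g ⋆ F s) (suc n) + suc n * (g ⋆ G (suc s)) n              ∎
    where
    shift : ℕ → ℕ
    shift l = l * G (suc s) (l ∸ 1)
    shifted : (g ⋆ shift) (suc n) ≡ suc n * (g ⋆ G (suc s)) n
    shifted = trans (⋆-comm g shift (suc n)) (trans (⋆-shiftˡ (G (suc s)) g n) (cong (suc n *_) (⋆-comm (G (suc s)) g n)))

  diagPow : ℕ → ℕ → ℕ
  diagPow x k = (x + k) ^ k

  abel : ℕ → ℕ → ℕ
  abel x zero    = 1
  abel x (suc k) = x * (x + suc k) ^ k

  abel-suc : ∀ x k → abel x (suc k) ≡ x * diagPow (suc x) k
  abel-suc x k = cong (λ b → x * b ^ k) (+-suc x k)

  diagPow-splitsAlong-abel : diagPow SplitsAlong abel
  diagPow-splitsAlong-abel x zero    = refl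
  diagPow-splitsAlong-abel x (suc l) = begin
    (x + suc l) * (x + suc l) ^ l                 ≡⟨ *-distribʳ-+ ((x + suc l) ^ l) x (suc l) ⟩
    x * (x + suc l) ^ l + suc l * (x + suc l) ^ l ≡⟨ cong (λ b → x * (x + suc l) ^ l + suc l * b ^ l) (+-suc x l) ⟩
    x * (x + suc l) ^ l + suc l * (suc x + l) ^ l ∎

  AbelStable : (ℕ → ℕ → ℕ) → Set
  AbelStable F = ∀ x s n → (abel x ⋆ F s) n ≡ F (x + s) n

  -- Abel's binomial identity and its companion for products of Abel polynomials,
  -- proved together: each one's inductive step needs the other.
  mutual
    abel-⋆-abel : ∀ x y n → (abel x ⋆ abel y) n ≡ abel (x + y) n
    abel-⋆-abel x y zero    = refl
    abel-⋆-abel x y (suc n) = begin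
      (abel x ⋆ abel y) (suc n)
        ≡⟨ ⋆-leibniz (abel x) (abel y) n ⟩
      (abel x ⋆ (abel y ∘ suc)) n + ((abel x ∘ suc) ⋆ abel y) n
        ≡⟨ cong₂ _+_ (derivative x y) (trans (⋆-comm _ _ n) (derivative y x)) ⟩
      y * (x + suc y + n) ^ n + x * (y + suc x + n) ^ n
        ≡⟨ cong₂ (λ b c → y * b ^ n + x * c ^ n) (shuffle x y n) (trans (cong (_+ n) (+-comm y (suc x))) (shuffle′ x y n)) ⟩
      y * (x + y + suc n) ^ n + x * (x + y + suc n) ^ n
        ≡⟨ *-distribʳ-+ ((x + y + suc n) ^ n) y x ⟨
      (y + x) * (x + y + suc n) ^ n
        ≡⟨ cong (_* (x + y + suc n) ^ n) (+-comm y x) ⟩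
      (x + y) * (x + y + suc n) ^ n
        ∎
      where
      derivative : ∀ x y → (abel x ⋆ (abel y ∘ suc)) n ≡ y * diagPow (x + suc y) n
      derivative x y = begin
        (abel x ⋆ (abel y ∘ suc)) n               ≡⟨ ⋆-cong (λ _ → refl) (abel-suc y) n ⟩
        (abel x ⋆ (λ l → y * diagPow (suc y) l)) n ≡⟨ ⋆-scaleʳ y (abel x) (diagPow (suc y)) n ⟩
        y * (abel x ⋆ diagPow (suc y)) n          ≡⟨ cong (y *_) (diagPow-abelStable x (suc y) n) ⟩
        y * diagPow (x + suc y) n                 ∎
      shuffle : ∀ x y n → x + suc y + n ≡ x + y + suc n
      shuffle = solve-∀
      shuffle′ : ∀ x y n → suc x + y + n ≡ x + y + suc n
      shuffle′ = solve-∀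

    diagPow-abelStable : AbelStable diagPow
    diagPow-abelStable x y zero    = refl
    diagPow-abelStable x y (suc n) = begin
      (abel x ⋆ diagPow y) (suc n)
        ≡⟨ ⋆-split diagPow-splitsAlong-abel (abel x) y n ⟩
      (abel x ⋆ abel y) (suc n) + suc n * (abel x ⋆ diagPow (suc y)) n
        ≡⟨ cong₂ (λ a b → a + suc n * b) (abel-⋆-abel x y (suc n)) (diagPow-abelStable x (suc y) n) ⟩
      abel (x + y) (suc n) + suc n * diagPow (x + suc y) n
        ≡⟨ cong (λ z → abel (x + y) (suc n) + suc n * diagPow z n) (+-suc x y) ⟩
      abel (x + y) (suc n) + suc n * diagPow (suc (x + y)) n
        ≡⟨ diagPow-splitsAlong-abel (x + y) (suc n) ⟨
      diagPow (x + y) (suc n)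
        ∎

  accum : (ℕ → ℕ → ℕ) → ℕ → ℕ → ℕ
  accum F s zero    = F s 0
  accum F s (suc n) = F s (suc n) + suc n * accum F (suc s) n

  accum-splitsAlong : ∀ F → accum F SplitsAlong F
  accum-splitsAlong F s zero    = sym (+-identityʳ (F s 0))
  accum-splitsAlong F s (suc l) = refl

  accum-abelStable : ∀ {F} → AbelStable F → AbelStable (accum F)
  accum-abelStable {F} F-stable x s zero    = F-stable x s 0
  accum-abelStable {F} F-stable x s (suc n) = begin
    (abel x ⋆ accum F s) (suc n)
      ≡⟨ ⋆-split (accum-splitsAlong F) (abel x) s n ⟩
    (abel x ⋆ F s) (suc n) + suc n * (abel x ⋆ accum F (suc s)) n
      ≡⟨ cong₂ (λ a b → a + suc n * b) (F-stable x s (suc n)) (accum-abelStable F-stable x (suc s) n) ⟩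
    F (x + s) (suc n) + suc n * accum F (x + suc s) n
      ≡⟨ cong (λ z → F (x + s) (suc n) + suc n * accum F z n) (+-suc x s) ⟩
    accum F (x + s) (suc n)
      ∎

  diagPow-⋆ : ∀ {F} → AbelStable F → ∀ x s n → (diagPow x ⋆ F s) n ≡ accum F (x + s) n
  diagPow-⋆ {F} F-stable x s zero    = F-stable x s 0
  diagPow-⋆ {F} F-stable x s (suc n) = begin
    (diagPow x ⋆ F s) (suc n)
      ≡⟨ ⋆-comm (diagPow x) (F s) (suc n) ⟩
    (F s ⋆ diagPow x) (suc n)
      ≡⟨ ⋆-split diagPow-splitsAlong-abel (F s) x n ⟩
    (F s ⋆ abel x) (suc n) + suc n * (F s ⋆ diagPow (suc x)) n
      ≡⟨ cong₂ (λ a b → a + suc n * b) (⋆-comm (F s) (abel x) (suc n)) (⋆-comm (F s) (diagPow (suc x)) n) ⟩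
    (abel x ⋆ F s) (suc n) + suc n * (diagPow (suc x) ⋆ F s) n
      ≡⟨ cong₂ (λ a b → a + suc n * b) (F-stable x s (suc n)) (diagPow-⋆ F-stable (suc x) s n) ⟩
    accum F (x + s) (suc n)
      ∎

  accum-closedForm : ∀ {F a b} → (λ _ → b) SplitsAlong (λ _ → a) →
                     (∀ s n → F s n ≡ (((s + n) ^_) ⋆ a) n) → ∀ s n → accum F s n ≡ (((s + n) ^_) ⋆ b) n
  accum-closedForm {F} {a} {b} b-split F-closed s zero = begin
    F s 0                      ≡⟨ F-closed s 0 ⟩
    (((s + 0) ^_) ⋆ a) 0       ≡⟨ cong (λ c → (0 C 0) * (s + 0) ^ 0 * c) (trans (b-split s 0) (+-identityʳ (a 0))) ⟨
    (((s + 0) ^_) ⋆ b) 0       ∎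
  accum-closedForm {F} {a} {b} b-split F-closed s (suc n) = begin
    F s (suc n) + suc n * accum F (suc s) n
      ≡⟨ cong₂ (λ c d → c + suc n * d) (F-closed s (suc n)) (accum-closedForm b-split F-closed (suc s) n) ⟩
    ((N ^_) ⋆ a) (suc n) + suc n * (((suc s + n) ^_) ⋆ b) n
      ≡⟨ cong (λ c → ((N ^_) ⋆ a) (suc n) + suc n * (((c ^_) ⋆ b) n)) (sym (+-suc s n)) ⟩
    ((N ^_) ⋆ a) (suc n) + suc n * ((N ^_) ⋆ b) n
      ≡⟨ ⋆-split b-split (N ^_) 0 n ⟨
    ((N ^_) ⋆ b) (suc n)
      ∎
    where
    N : ℕ
    N = s + suc n

  accum-diagPow-closedForm : ∀ s n → accum diagPow s n ≡ (((s + n) ^_) ⋆ _!) n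
  accum-diagPow-closedForm = accum-closedForm !-split (λ s n → sym (⋆-identityʳ ((s + n) ^_) n))
    where
    !-split : (λ _ → _!) SplitsAlong (λ _ → δ₀)
    !-split s zero    = refl
    !-split s (suc l) = refl

  accum²-diagPow-closedForm : ∀ s n → accum (accum diagPow) s n ≡ (((s + n) ^_) ⋆ (λ t → suc t !)) n
  accum²-diagPow-closedForm = accum-closedForm suc!-split accum-diagPow-closedForm
    where
    suc!-split : (λ _ t → suc t !) SplitsAlong (λ _ → _!)
    suc!-split s zero    = refl
    suc!-split s (suc l) = refl

  accum²-diagPow+s*accum-diagPow : ∀ s n → accum (accum diagPow) s n + s * accum diagPow s n ≡ accum diagPow s n + (s + n) ^ suc n
  accum²-diagPow+s*accum-diagPow s zero    = cong (λ b → 1 + b * 1) (sym (+-identityʳ s))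
  accum²-diagPow+s*accum-diagPow s (suc n) = begin
    Rs + suc n * a + s * Rs    ≡⟨ +-assoc Rs _ _ ⟩
    Rs + (suc n * a + s * Rs)  ≡⟨ cong (Rs +_) (begin
        suc n * a + s * (e + suc n * r) ≡⟨ regroup (suc n) s a r e ⟩
        suc n * (a + s * r) + s * e     ≡⟨ cong (λ c → suc n * c + s * e) tail ⟩
        suc n * e + s * e               ≡⟨ *-distribʳ-+ e (suc n) s ⟨
        (suc n + s) * e                 ≡⟨ cong (_* e) (+-comm (suc n) s) ⟩
        (s + suc n) * e                 ∎) ⟩
    Rs + (s + suc n) ^ suc (suc n) ∎
    where
    Rs a r e : ℕ
    Rs = accum diagPow s (suc n)
    a = accum (accum diagPow) (suc s) n
    r = accum diagPow (suc s) n
    e = (s + suc n) ^ suc n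
    regroup : ∀ m s a r e → m * a + s * (e + m * r) ≡ m * (a + s * r) + s * e
    regroup = solve-∀
    tail : a + s * r ≡ e
    tail = +-cancelˡ-≡ r _ _ (begin
      r + (a + s * r) ≡⟨ x∙yz≈y∙xz r a (s * r) ⟩
      a + suc s * r   ≡⟨ accum²-diagPow+s*accum-diagPow (suc s) n ⟩
      r + (suc s + n) ^ suc n ≡⟨ cong (λ b → r + b ^ suc n) (+-suc s n) ⟨
      r + e ∎)

  ξ-numerator : ∀ m → (diagPow 0 ⋆ diagPow 0) m ≡ ((m ^_) ⋆ _!) m
  ξ-numerator m = trans (diagPow-⋆ diagPow-abelStable 0 0 m) (accum-diagPow-closedForm 0 m)

  ξ₂-numerator-accum : ∀ m → (diagPow 0 ⋆ (diagPow 0 ⋆ diagPow 0)) m ≡ accum (accum diagPow) 0 m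
  ξ₂-numerator-accum m = trans (⋆-cong (λ _ → refl) (diagPow-⋆ diagPow-abelStable 0 0) m)
                               (diagPow-⋆ (accum-abelStable diagPow-abelStable) 0 0 m)

  ξ₂-numerator : ∀ m → (diagPow 0 ⋆ (diagPow 0 ⋆ diagPow 0)) m ≡ ((λ t → suc t !) ⋆ (m ^_)) m
  ξ₂-numerator m = trans (ξ₂-numerator-accum m) (trans (accum²-diagPow-closedForm 0 m) (⋆-comm (m ^_) (λ t → suc t !) m))

  ξ₂-numerator≡ξ-numerator+m^[1+m] : ∀ m → (diagPow 0 ⋆ (diagPow 0 ⋆ diagPow 0)) m ≡ (diagPow 0 ⋆ diagPow 0) m + m ^ suc m
  ξ₂-numerator≡ξ-numerator+m^[1+m] m = begin
    (diagPow 0 ⋆ (diagPow 0 ⋆ diagPow 0)) m      ≡⟨ ξ₂-numerator-accum m ⟩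
    accum (accum diagPow) 0 m                     ≡⟨ +-identityʳ _ ⟨
    accum (accum diagPow) 0 m + 0 * accum diagPow 0 m ≡⟨ accum²-diagPow+s*accum-diagPow 0 m ⟩
    accum diagPow 0 m + m ^ suc m                 ≡⟨ cong (_+ m ^ suc m) (diagPow-⋆ diagPow-abelStable 0 0 m) ⟨
    (diagPow 0 ⋆ diagPow 0) m + m ^ suc m         ∎

open import Data.Nat as ℕ using (zero; suc; _∸_; _!)
open import Data.Nat.Combinatorics using (_C_)
open import Data.Nat.Tactic.RingSolver using (solve-∀)
import Data.Nat.Properties as ℕ
open import Function using (_∘_; it)
open import Data.Integer as ℤ using (+_)
import Data.Integer.Properties as ℤ
open import Data.Rational using (ℚ; 1ℚ; _+_; _*_; _-_; _/_; fromℚᵘ)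
import Data.Rational.Properties as ℚ
open import Data.Rational.Properties using (toℚᵘ-injective; toℚᵘ-fromℚᵘ; fromℚᵘ-cong; toℚᵘ-homo-+; toℚᵘ-homo-*)
import Data.Rational.Unnormalised as ℚᵘ
import Data.Rational.Unnormalised.Properties as ℚᵘ
open import Data.Rational.Solver using (module +-*-Solver)
open import Relation.Binary.PropositionalEquality
open AbelConvolution
open ≡-Reasoning

fromℚᵘ-homo-+ : ∀ p q → fromℚᵘ (p ℚᵘ.+ q) ≡ fromℚᵘ p + fromℚᵘ q
fromℚᵘ-homo-+ p q = toℚᵘ-injective (ℚᵘ.≃-trans (toℚᵘ-fromℚᵘ (p ℚᵘ.+ q))
  (ℚᵘ.≃-sym (ℚᵘ.≃-trans (toℚᵘ-homo-+ (fromℚᵘ p) (fromℚᵘ q)) (ℚᵘ.+-cong (toℚᵘ-fromℚᵘ p) (toℚᵘ-fromℚᵘ q)))))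

fromℚᵘ-homo-* : ∀ p q → fromℚᵘ (p ℚᵘ.* q) ≡ fromℚᵘ p * fromℚᵘ q
fromℚᵘ-homo-* p q = toℚᵘ-injective (ℚᵘ.≃-trans (toℚᵘ-fromℚᵘ (p ℚᵘ.* q))
  (ℚᵘ.≃-sym (ℚᵘ.≃-trans (toℚᵘ-homo-* (fromℚᵘ p) (fromℚᵘ q)) (ℚᵘ.*-cong (toℚᵘ-fromℚᵘ p) (toℚᵘ-fromℚᵘ q)))))

/-cross : ∀ a b c d .{{_ : NonZero b}} .{{_ : NonZero d}} → a ℕ.* d ≡ c ℕ.* b → + a / b ≡ + c / d
/-cross a (suc b) c (suc d) ad≡cb =
  fromℚᵘ-cong {ℚᵘ.mkℚᵘ (+ a) b} {ℚᵘ.mkℚᵘ (+ c) d} (ℚᵘ.*≡* (trans (sym (ℤ.pos-* a (suc d))) (trans (cong +_ ad≡cb) (ℤ.pos-* c (suc b)))))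

/-homo-* : ∀ a b c d .{{_ : NonZero b}} .{{_ : NonZero d}} →
           (+ a / b) * (+ c / d) ≡ (+ (a ℕ.* c) / (b ℕ.* d)) {{ℕ.m*n≢0 b d}}
/-homo-* a (suc b) c (suc d) =
  sym (trans (cong (λ n → n / (suc b ℕ.* suc d)) (ℤ.pos-* a c)) (fromℚᵘ-homo-* (ℚᵘ.mkℚᵘ (+ a) b) (ℚᵘ.mkℚᵘ (+ c) d)))

ι-homo-+ : ∀ a b → ι (a ℕ.+ b) ≡ ι a + ι b
ι-homo-+ a b = trans (fromℚᵘ-cong {ℚᵘ.mkℚᵘ (+ (a ℕ.+ b)) 0} {ℚᵘ.mkℚᵘ (+ a) 0 ℚᵘ.+ ℚᵘ.mkℚᵘ (+ b) 0}
  (ℚᵘ.*≡* (cong (ℤ._* + 1) (trans (ℤ.pos-+ a b) (sym (cong₂ ℤ._+_ (ℤ.*-identityʳ (+ a)) (ℤ.*-identityʳ (+ b))))))))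
  (fromℚᵘ-homo-+ (ℚᵘ.mkℚᵘ (+ a) 0) (ℚᵘ.mkℚᵘ (+ b) 0))

ι-homo-* : ∀ a b → ι (a ℕ.* b) ≡ ι a * ι b
ι-homo-* a b = sym (/-homo-* a 1 b 1)

ι-homo-*³ : ∀ a b c → ι (a ℕ.* b ℕ.* c) ≡ ι a * ι b * ι c
ι-homo-*³ a b c = trans (ι-homo-* (a ℕ.* b) c) (cong (_* ι c) (ι-homo-* a b))

ι-homo-^ : ∀ a n → ι (a ℕ.^ n) ≡ ι a ^ℚ n
ι-homo-^ a zero    = refl
ι-homo-^ a (suc n) = trans (ι-homo-* a (a ℕ.^ n)) (cong (ι a *_) (ι-homo-^ a n))

^ℚ-distribʳ-* : ∀ x y n → (x * y) ^ℚ n ≡ x ^ℚ n * y ^ℚ n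
^ℚ-distribʳ-* x y zero    = refl
^ℚ-distribʳ-* x y (suc n) = trans (cong ((x * y) *_) (^ℚ-distribʳ-* x y n)) (interchange x y (x ^ℚ n) (y ^ℚ n))
  where
  open +-*-Solver
  interchange : ∀ x y a b → x * y * (a * b) ≡ x * a * (y * b)
  interchange = solve 4 (λ x y a b → x :* y :* (a :* b) := x :* a :* (y :* b)) refl

^ℚ-homo-+ : ∀ x m n → x ^ℚ (m ℕ.+ n) ≡ x ^ℚ m * x ^ℚ n
^ℚ-homo-+ x zero    n = sym (ℚ.*-identityˡ (x ^ℚ n))
^ℚ-homo-+ x (suc m) n = trans (cong (x *_) (^ℚ-homo-+ x m n)) (sym (ℚ.*-assoc x (x ^ℚ m) (x ^ℚ n)))

ι*-^ℚ : ∀ a u n → (ι a * u) ^ℚ n ≡ ι (a ℕ.^ n) * u ^ℚ n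
ι*-^ℚ a u n = trans (^ℚ-distribʳ-* (ι a) u n) (cong (_* u ^ℚ n) (sym (ι-homo-^ a n)))

ι*-∸ : ∀ {a b} → b ℕ.≤ a → ∀ u → ι a * u - ι b * u ≡ ι (a ∸ b) * u
ι*-∸ {a} {b} b≤a u = begin
  ι a * u - ι b * u                   ≡⟨ cong (λ c → ι c * u - ι b * u) (ℕ.m∸n+n≡m b≤a) ⟨
  ι (a ∸ b ℕ.+ b) * u - ι b * u       ≡⟨ cong (λ c → c * u - ι b * u) (ι-homo-+ (a ∸ b) b) ⟩
  (ι (a ∸ b) + ι b) * u - ι b * u     ≡⟨ cancel (ι (a ∸ b)) (ι b) u ⟩
  ι (a ∸ b) * u                       ∎
  where
  open +-*-Solver
  cancel : ∀ x y u → (x + y) * u - y * u ≡ x * u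
  cancel = solve 3 (λ x y u → (x :+ y) :* u :- y :* u := x :* u) refl

Σ-cong : ∀ n {f g : ℕ → ℚ} → (∀ k → k ℕ.≤ n → f k ≡ g k) → Σ[0… n ] f ≡ Σ[0… n ] g
Σ-cong zero    f≗g = f≗g 0 ℕ.z≤n
Σ-cong (suc n) f≗g = cong₂ _+_ (Σ-cong n λ k k≤n → f≗g k (ℕ.m≤n⇒m≤1+n k≤n)) (f≗g (suc n) ℕ.≤-refl)

Σ-distribʳ-* : ∀ n (f : ℕ → ℚ) c → Σ[0… n ] (λ k → f k * c) ≡ Σ[0… n ] f * c
Σ-distribʳ-* zero    f c = refl
Σ-distribʳ-* (suc n) f c =
  trans (cong (_+ f (suc n) * c) (Σ-distribʳ-* n f c)) (sym (ℚ.*-distribʳ-+ c (Σ[0… n ] f) (f (suc n))))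

Σ-ι : ∀ n (f : ℕ → ℕ) → Σ[0… n ] (λ k → ι (f k)) ≡ ι (Σℕ[0… n ] f)
Σ-ι zero    f = refl
Σ-ι (suc n) f = trans (cong (_+ ι (f (suc n))) (Σ-ι n f)) (sym (ι-homo-+ (Σℕ[0… n ] f) (f (suc n))))

ι*1/≡1 : ∀ n .{{_ : NonZero n}} → ι n * (+ 1 / n) ≡ 1ℚ
ι*1/≡1 n = trans (/-homo-* n 1 1 n) (/-cross (n ℕ.* 1) (1 ℕ.* n) 1 1 {{ℕ.m*n≢0 1 n}} (regroup n))
  where
  regroup : ∀ n → n ℕ.* 1 ℕ.* 1 ≡ 1 ℕ.* (1 ℕ.* n)
  regroup = solve-∀

module _ (m : ℕ) .{{_ : NonZero m}} where

  m⁻¹ : ℚ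
  m⁻¹ = + 1 / m

  frac≡ι*m⁻¹ : ∀ k → frac k m ≡ ι k * m⁻¹
  frac≡ι*m⁻¹ k = sym (trans (/-homo-* k 1 1 m) (/-cross (k ℕ.* 1) (1 ℕ.* m) k m {{ℕ.m*n≢0 1 m}} (regroup k m)))
    where
    regroup : ∀ k m → k ℕ.* 1 ℕ.* m ≡ k ℕ.* (1 ℕ.* m)
    regroup = solve-∀

  1/m^≡m⁻¹^ℚ : ∀ n → (+ 1 / m ℕ.^ n) {{ℕ.m^n≢0 m n}} ≡ m⁻¹ ^ℚ n
  1/m^≡m⁻¹^ℚ zero    = refl
  1/m^≡m⁻¹^ℚ (suc n) = trans (sym (/-homo-* 1 m 1 (m ℕ.^ n) {{it}} {{ℕ.m^n≢0 m n}})) (cong (m⁻¹ *_) (1/m^≡m⁻¹^ℚ n))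

  1-frac : ∀ {k} → k ℕ.≤ m → 1ℚ - frac k m ≡ ι (m ∸ k) * m⁻¹
  1-frac {k} k≤m = trans (cong₂ _-_ (sym (ι*1/≡1 m)) (frac≡ι*m⁻¹ k)) (ι*-∸ k≤m m⁻¹)

  1-frac-frac : ∀ {j k} → j ℕ.≤ m → k ℕ.≤ m ∸ j → 1ℚ - frac j m - frac k m ≡ ι (m ∸ j ∸ k) * m⁻¹
  1-frac-frac {j} {k} j≤m k≤m∸j = trans (cong₂ _-_ (1-frac j≤m) (frac≡ι*m⁻¹ k)) (ι*-∸ k≤m∸j m⁻¹)

  ξ-term : ∀ k → k ℕ.≤ m →
           ι (m C k) * (frac k m ^ℚ k) * ((1ℚ - frac k m) ^ℚ (m ∸ k)) ≡
           ι ((m C k) ℕ.* k ℕ.^ k ℕ.* (m ∸ k) ℕ.^ (m ∸ k)) * m⁻¹ ^ℚ m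
  ξ-term k k≤m = begin
    ι c * (frac k m ^ℚ k) * ((1ℚ - frac k m) ^ℚ l)
      ≡⟨ cong₂ (λ x y → ι c * x ^ℚ k * y ^ℚ l) (frac≡ι*m⁻¹ k) (1-frac k≤m) ⟩
    ι c * (ι k * m⁻¹) ^ℚ k * (ι l * m⁻¹) ^ℚ l
      ≡⟨ cong₂ (λ x y → ι c * x * y) (ι*-^ℚ k m⁻¹ k) (ι*-^ℚ l m⁻¹ l) ⟩
    ι c * (ι (k ℕ.^ k) * m⁻¹ ^ℚ k) * (ι (l ℕ.^ l) * m⁻¹ ^ℚ l)
      ≡⟨ regroup (ι c) (ι (k ℕ.^ k)) (ι (l ℕ.^ l)) (m⁻¹ ^ℚ k) (m⁻¹ ^ℚ l) ⟩
    ι c * ι (k ℕ.^ k) * ι (l ℕ.^ l) * (m⁻¹ ^ℚ k * m⁻¹ ^ℚ l)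
      ≡⟨ cong₂ _*_ (ι-homo-*³ c (k ℕ.^ k) (l ℕ.^ l)) (^ℚ-homo-+ m⁻¹ k l) ⟨
    ι (c ℕ.* k ℕ.^ k ℕ.* l ℕ.^ l) * m⁻¹ ^ℚ (k ℕ.+ l)
      ≡⟨ cong (λ e → ι (c ℕ.* k ℕ.^ k ℕ.* l ℕ.^ l) * m⁻¹ ^ℚ e) (ℕ.m+[n∸m]≡n k≤m) ⟩
    ι (c ℕ.* k ℕ.^ k ℕ.* l ℕ.^ l) * m⁻¹ ^ℚ m
      ∎
    where
    c l : ℕ
    c = m C k
    l = m ∸ k
    open +-*-Solver
    regroup : ∀ c a b p q → c * (a * p) * (b * q) ≡ c * a * b * (p * q)
    regroup = solve 5 (λ c a b p q → c :* (a :* p) :* (b :* q) := c :* a :* b :* (p :* q)) refl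

  ξ-reduction : ξ m ≡ ι ((diagPow 0 ⋆ diagPow 0) m) * m⁻¹ ^ℚ m
  ξ-reduction = begin
    ξ m                                                             ≡⟨ Σ-cong m ξ-term ⟩
    Σ[0… m ] (λ k → ι ((m C k) ℕ.* k ℕ.^ k ℕ.* (m ∸ k) ℕ.^ (m ∸ k)) * m⁻¹ ^ℚ m) ≡⟨ Σ-distribʳ-* m _ (m⁻¹ ^ℚ m) ⟩
    Σ[0… m ] (λ k → ι ((m C k) ℕ.* k ℕ.^ k ℕ.* (m ∸ k) ℕ.^ (m ∸ k))) * m⁻¹ ^ℚ m ≡⟨ cong (_* m⁻¹ ^ℚ m) (Σ-ι m _) ⟩
    ι ((diagPow 0 ⋆ diagPow 0) m) * m⁻¹ ^ℚ m                      ∎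

  ξ₂-term : ∀ j k → j ℕ.≤ m → k ℕ.≤ m ∸ j →
            ι (m C j) * ι ((m ∸ j) C k) * (frac j m ^ℚ j) * (frac k m ^ℚ k) * ((1ℚ - frac j m - frac k m) ^ℚ (m ∸ j ∸ k)) ≡
            ι ((m C j) ℕ.* j ℕ.^ j ℕ.* (((m ∸ j) C k) ℕ.* k ℕ.^ k ℕ.* (m ∸ j ∸ k) ℕ.^ (m ∸ j ∸ k))) * m⁻¹ ^ℚ m
  ξ₂-term j k j≤m k≤m∸j = begin
    ι c * ι d * (frac j m ^ℚ j) * (frac k m ^ℚ k) * ((1ℚ - frac j m - frac k m) ^ℚ l)
      ≡⟨ cong (λ z → ι c * ι d * (frac j m ^ℚ j) * (frac k m ^ℚ k) * z ^ℚ l) (1-frac-frac j≤m k≤m∸j) ⟩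
    ι c * ι d * (frac j m ^ℚ j) * (frac k m ^ℚ k) * (ι l * m⁻¹) ^ℚ l
      ≡⟨ cong₂ (λ x y → ι c * ι d * x ^ℚ j * y ^ℚ k * (ι l * m⁻¹) ^ℚ l) (frac≡ι*m⁻¹ j) (frac≡ι*m⁻¹ k) ⟩
    ι c * ι d * (ι j * m⁻¹) ^ℚ j * (ι k * m⁻¹) ^ℚ k * (ι l * m⁻¹) ^ℚ l
      ≡⟨ cong₂ (λ x y → x * y) (cong₂ (λ x y → ι c * ι d * x * y) (ι*-^ℚ j m⁻¹ j) (ι*-^ℚ k m⁻¹ k)) (ι*-^ℚ l m⁻¹ l) ⟩
    ι c * ι d * (ι (j ℕ.^ j) * m⁻¹ ^ℚ j) * (ι (k ℕ.^ k) * m⁻¹ ^ℚ k) * (ι (l ℕ.^ l) * m⁻¹ ^ℚ l)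
      ≡⟨ regroup (ι c) (ι d) (ι (j ℕ.^ j)) (ι (k ℕ.^ k)) (ι (l ℕ.^ l)) (m⁻¹ ^ℚ j) (m⁻¹ ^ℚ k) (m⁻¹ ^ℚ l) ⟩
    ι c * ι (j ℕ.^ j) * (ι d * ι (k ℕ.^ k) * ι (l ℕ.^ l)) * (m⁻¹ ^ℚ j * (m⁻¹ ^ℚ k * m⁻¹ ^ℚ l))
      ≡⟨ cong₂ _*_ (trans (ι-homo-* (c ℕ.* j ℕ.^ j) _) (cong₂ _*_ (ι-homo-* c (j ℕ.^ j)) (ι-homo-*³ d (k ℕ.^ k) (l ℕ.^ l))))
                   (trans (^ℚ-homo-+ m⁻¹ j (k ℕ.+ l)) (cong (m⁻¹ ^ℚ j *_) (^ℚ-homo-+ m⁻¹ k l))) ⟨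
    ι (c ℕ.* j ℕ.^ j ℕ.* (d ℕ.* k ℕ.^ k ℕ.* l ℕ.^ l)) * m⁻¹ ^ℚ (j ℕ.+ (k ℕ.+ l))
      ≡⟨ cong (λ e → ι (c ℕ.* j ℕ.^ j ℕ.* (d ℕ.* k ℕ.^ k ℕ.* l ℕ.^ l)) * m⁻¹ ^ℚ e)
              (trans (cong (j ℕ.+_) (ℕ.m+[n∸m]≡n k≤m∸j)) (ℕ.m+[n∸m]≡n j≤m)) ⟩
    ι (c ℕ.* j ℕ.^ j ℕ.* (d ℕ.* k ℕ.^ k ℕ.* l ℕ.^ l)) * m⁻¹ ^ℚ m
      ∎
    where
    c d l : ℕ
    c = m C j
    d = (m ∸ j) C k
    l = m ∸ j ∸ k
    open +-*-Solver
    regroup : ∀ c d a b e p q r → c * d * (a * p) * (b * q) * (e * r) ≡ c * a * (d * b * e) * (p * (q * r))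
    regroup = solve 8 (λ c d a b e p q r → c :* d :* (a :* p) :* (b :* q) :* (e :* r) := c :* a :* (d :* b :* e) :* (p :* (q :* r))) refl

  ξ₂-reduction : ξ₂ m ≡ ι ((diagPow 0 ⋆ (diagPow 0 ⋆ diagPow 0)) m) * m⁻¹ ^ℚ m
  ξ₂-reduction = begin
    ξ₂ m                                                          ≡⟨ Σ-cong m inner ⟩
    Σ[0… m ] (λ j → ι (outer j) * m⁻¹ ^ℚ m)                       ≡⟨ Σ-distribʳ-* m (ι ∘ outer) (m⁻¹ ^ℚ m) ⟩
    Σ[0… m ] (λ j → ι (outer j)) * m⁻¹ ^ℚ m                       ≡⟨ cong (_* m⁻¹ ^ℚ m) (Σ-ι m outer) ⟩
    ι ((diagPow 0 ⋆ (diagPow 0 ⋆ diagPow 0)) m) * m⁻¹ ^ℚ m        ∎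
    where
    outer : ℕ → ℕ
    outer j = (m C j) ℕ.* j ℕ.^ j ℕ.* (diagPow 0 ⋆ diagPow 0) (m ∸ j)
    summand : ℕ → ℕ → ℕ
    summand j k = (m C j) ℕ.* j ℕ.^ j ℕ.* (((m ∸ j) C k) ℕ.* k ℕ.^ k ℕ.* (m ∸ j ∸ k) ℕ.^ (m ∸ j ∸ k))
    inner : ∀ j → j ℕ.≤ m →
            Σ[0… m ∸ j ] (λ k → ι (m C j) * ι ((m ∸ j) C k) * (frac j m ^ℚ j) * (frac k m ^ℚ k)
                                  * ((1ℚ - frac j m - frac k m) ^ℚ (m ∸ j ∸ k))) ≡
            ι (outer j) * m⁻¹ ^ℚ m
    inner j j≤m = begin
      _                                                 ≡⟨ Σ-cong (m ∸ j) (λ k → ξ₂-term j k j≤m) ⟩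
      Σ[0… m ∸ j ] (λ k → ι (summand j k) * m⁻¹ ^ℚ m)   ≡⟨ Σ-distribʳ-* (m ∸ j) (ι ∘ summand j) (m⁻¹ ^ℚ m) ⟩
      Σ[0… m ∸ j ] (λ k → ι (summand j k)) * m⁻¹ ^ℚ m   ≡⟨ cong (_* m⁻¹ ^ℚ m) (Σ-ι (m ∸ j) (summand j)) ⟩
      ι (Σℕ[0… m ∸ j ] (summand j)) * m⁻¹ ^ℚ m          ≡⟨ cong (λ n → ι n * m⁻¹ ^ℚ m) (Σℕ-distribˡ-* (m ∸ j) ((m C j) ℕ.* j ℕ.^ j) _) ⟩
      ι (outer j) * m⁻¹ ^ℚ m                            ∎

  rhs₁-reduction : rhs₁ m ≡ m⁻¹ ^ℚ m * ι (((m ℕ.^_) ⋆ _!) m)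
  rhs₁-reduction = cong₂ _*_ (1/m^≡m⁻¹^ℚ m) (trans (Σ-cong m term) (Σ-ι m _))
    where
    term : ∀ j → j ℕ.≤ m → ι (m ℕ.^ j) * divFact (m !) j ≡ ι ((m C j) ℕ.* m ℕ.^ j ℕ.* (m ∸ j) !)
    term j j≤m = begin
      ι (m ℕ.^ j) * divFact (m !) j               ≡⟨ cong (ι (m ℕ.^ j) *_) (/-cross (m !) (j !) ((m C j) ℕ.* (m ∸ j) !) 1 {{j ℕ.!≢0}} factorials) ⟩
      ι (m ℕ.^ j) * ι ((m C j) ℕ.* (m ∸ j) !)     ≡⟨ ι-homo-* (m ℕ.^ j) _ ⟨
      ι (m ℕ.^ j ℕ.* ((m C j) ℕ.* (m ∸ j) !))     ≡⟨ cong ι (regroup (m ℕ.^ j) (m C j) ((m ∸ j) !)) ⟩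
      ι ((m C j) ℕ.* m ℕ.^ j ℕ.* (m ∸ j) !)       ∎
      where
      regroup : ∀ p c f → p ℕ.* (c ℕ.* f) ≡ c ℕ.* p ℕ.* f
      regroup = solve-∀
      rearrange : ∀ c a b → c ℕ.* (a ℕ.* b) ≡ c ℕ.* b ℕ.* a
      rearrange = solve-∀
      factorials : m ! ℕ.* 1 ≡ (m C j) ℕ.* (m ∸ j) ! ℕ.* j !
      factorials = trans (ℕ.*-identityʳ (m !)) (trans (sym (nCk*[k!*[n∸k]!]≡n! j≤m)) (rearrange (m C j) (j !) ((m ∸ j) !)))

  rhs₂-reduction : rhs₂ m ≡ m⁻¹ ^ℚ m * ι (((λ t → suc t !) ⋆ (m ℕ.^_)) m)
  rhs₂-reduction = cong₂ _*_ (1/m^≡m⁻¹^ℚ m) (trans (Σ-cong m λ j _ → term j) (Σ-ι m _))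
    where
    term : ∀ j → ι (m ℕ.^ (m ∸ j)) * ι (m C j) * ι (suc j !) ≡ ι ((m C j) ℕ.* suc j ! ℕ.* m ℕ.^ (m ∸ j))
    term j = trans (sym (ι-homo-*³ (m ℕ.^ (m ∸ j)) (m C j) (suc j !))) (cong ι (rotate (m ℕ.^ (m ∸ j)) (m C j) (suc j !)))
      where
      rotate : ∀ p c f → p ℕ.* c ℕ.* f ≡ c ℕ.* f ℕ.* p
      rotate = solve-∀

  ξ≡rhs₁ : ξ m ≡ rhs₁ m
  ξ≡rhs₁ = begin
    ξ m                                                ≡⟨ ξ-reduction ⟩
    ι ((diagPow 0 ⋆ diagPow 0) m) * m⁻¹ ^ℚ m           ≡⟨ ℚ.*-comm _ (m⁻¹ ^ℚ m) ⟩
    m⁻¹ ^ℚ m * ι ((diagPow 0 ⋆ diagPow 0) m)           ≡⟨ cong (λ n → m⁻¹ ^ℚ m * ι n) (ξ-numerator m) ⟩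
    m⁻¹ ^ℚ m * ι (((m ℕ.^_) ⋆ _!) m)                   ≡⟨ rhs₁-reduction ⟨
    rhs₁ m                                             ∎

  ξ₂≡rhs₂ : ξ₂ m ≡ rhs₂ m
  ξ₂≡rhs₂ = begin
    ξ₂ m                                               ≡⟨ ξ₂-reduction ⟩
    ι ((diagPow 0 ⋆ (diagPow 0 ⋆ diagPow 0)) m) * m⁻¹ ^ℚ m ≡⟨ ℚ.*-comm _ (m⁻¹ ^ℚ m) ⟩
    m⁻¹ ^ℚ m * ι ((diagPow 0 ⋆ (diagPow 0 ⋆ diagPow 0)) m) ≡⟨ cong (λ n → m⁻¹ ^ℚ m * ι n) (ξ₂-numerator m) ⟩
    m⁻¹ ^ℚ m * ι (((λ t → suc t !) ⋆ (m ℕ.^_)) m)      ≡⟨ rhs₂-reduction ⟨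
    rhs₂ m                                             ∎

  ξ₂≡ξ+m : ξ₂ m ≡ ξ m + ι m
  ξ₂≡ξ+m = begin
    ξ₂ m                                  ≡⟨ ξ₂-reduction ⟩
    ι ((diagPow 0 ⋆ (diagPow 0 ⋆ diagPow 0)) m) * U ≡⟨ cong (λ n → ι n * U) (ξ₂-numerator≡ξ-numerator+m^[1+m] m) ⟩
    ι (N ℕ.+ m ℕ.* m ℕ.^ m) * U           ≡⟨ cong (_* U) (trans (ι-homo-+ N _) (cong (λ x → ι N + x) (ι-homo-* m (m ℕ.^ m)))) ⟩
    (ι N + ι m * ι (m ℕ.^ m)) * U         ≡⟨ distrib (ι N) (ι m) (ι (m ℕ.^ m)) U ⟩
    ι N * U + ι m * (ι (m ℕ.^ m) * U)     ≡⟨ cong₂ (λ x y → x + ι m * y) ξ-reduction (sym ι[m^m]*U≡1) ⟨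
    ξ m + ι m * 1ℚ                        ≡⟨ cong (λ x → ξ m + x) (ℚ.*-identityʳ (ι m)) ⟩
    ξ m + ι m                             ∎
    where
    N : ℕ
    N = (diagPow 0 ⋆ diagPow 0) m
    U : ℚ
    U = m⁻¹ ^ℚ m
    ι[m^m]*U≡1 : ι (m ℕ.^ m) * U ≡ 1ℚ
    ι[m^m]*U≡1 = trans (cong (ι (m ℕ.^ m) *_) (sym (1/m^≡m⁻¹^ℚ m))) (ι*1/≡1 (m ℕ.^ m) {{ℕ.m^n≢0 m m}})
    open +-*-Solver
    distrib : ∀ a b c d → (a + b * c) * d ≡ a * d + b * (c * d)
    distrib = solve 4 (λ a b c d → (a :+ b :* c) :* d := a :* d :+ b :* (c :* d)) refl

mainTheorem1 : (m : ℕ) → .{{_ : NonZero m}} →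
    (ξ m ≡ rhs₁ m) × (ξ₂ m ≡ rhs₂ m) × (ξ₂ m ≡ ξ m + ι m)
mainTheorem1 m = ξ≡rhs₁ m , ξ₂≡rhs₂ m , ξ₂≡ξ+m m
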